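{- For each $n>0$, $\mathrm{STT}^{\downarrow}$ proves the following. Given chains $a^{n+1}\rightsquigarrow a^n\rightsquigarrow a^{n-1}\rightsquigarrow\dots\rightsquigarrow a^1$ and $b^n\rightsquigarrow b^{n-1}\rightsquigarrow\dots\rightsquigarrow b^1$: (1) if $a^{n+1}\rightsquigarrow b^n$, then for every $1\le i\le n$, $a^i\simeq b^i$ and $b^i\approx a^i$; (2) if there is $m$ with $1\le m\le n$ such that $b^m\approx a^m$ and $a^i\simeq b^i$ for all $m\le i\le n$, then $b^i\approx a^i$ for all $m\le i\le n$, and $a^{n+1}\rightsquigarrow b^n$.
   Context: $\mathrm{STT}$: types $n<\omega$; $b^n(a^m)$ well-formed iff $n=m+1$; identity only between same-type terms; classical logic with quantifier rules that instantiate/generalise only at the same type; Comprehension $\exists z^{n+1}\forall x^n(z^{n+1}(x^n)\leftrightarrow\phi(x^n))$; identity scheme $x^n=y^n\leftrightarrow\forall z^{n+1}(z^{n+1}(x^n)\leftrightarrow z^{n+1}(y^n))$. $\mathrm{STT}^{\downarrow}$ augments $\mathrm{STT}$ with, for each $n>0$, a binary relation symbol $\rightsquigarrow$ relating a type-$(n+1)$ term to a type-$n$ term ($a^{n+1}\rightsquigarrow b^n$); chains like $a\rightsquigarrow b\rightsquigarrow c$ abbreviate conjunctions. Abbreviations: $a^n\simeq b^n:\Leftrightarrow\forall x^{n-1}(a^n(x^{n-1})\leftrightarrow b^n(x^{n-1}))$ for $n>0$; $a^n\approx b^n:\Leftrightarrow\forall x^{n-1}(a^n\rightsquigarrow x^{n-1}\leftrightarrow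 b^n\rightsquigarrow x^{n-1})$ for $n>1$, and $a^1\approx b^1$ is always true. Axioms of $\mathrm{STT}^\downarrow$: Comprehension for type 1, $\exists z^1\forall x^0(z^1(x^0)\leftrightarrow\phi(x^0))$; for each $n\ge1$, $\forall y^n\exists z^{n+1}(z^{n+1}\rightsquigarrow y^n\wedge\forall x^n(z^{n+1}(x^n)\leftrightarrow\phi(x^n)))$ for $\phi$ not containing $z^{n+1}$ (may contain $\rightsquigarrow$ and $y^n$); and for each $n>0$: Down$_\exists$ $\forall z^{n+1}\exists x^n\,z^{n+1}\rightsquigarrow x^n$; Down$_{\mathrm{Sim}}$ $\forall z^{n+1}\forall x^n\forall y^n((z^{n+1}\rightsquigarrow x^n\wedge z^{n+1}\rightsquigarrow y^n)\to(x^n\simeq y^n\wedge y^n\approx x^n))$; Down$_{\mathrm{Max}}$ $\forall z^{n+1}\forall x^n\forall y^n((z^{n+1}\rightsquigarrow x^n\wedge x^n\simeq y^n\wedge y^n\approx x^n)\to z^{n+1}\rightsquigarrow y^n)$. -}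

module Defs where

open import Level using (Level; suc)
open import Data.Nat using (ℕ) renaming (suc to 1+)
open import Data.Product using (Σ; _×_)
open import Data.Unit.Polymorphic using (⊤)
open import Function.Bundles using (_⇔_)

-- Signature of STT↓ interpreted in a (Henkin-style, many-sorted) structure:
--   D n      : domain of type-n objects
--   app b a  : b^{n+1}(a^n)
--   z ↝ x    : z^{n+1} ↝ x^n, only for n > 0, i.e. from D (2+k) to D (1+k)
record Sig (ℓ : Level) : Set (suc ℓ) where
  infix 4 _↝_
  field
    D    : ℕ → Set ℓ
    app  : ∀ {n} → D (1+ n) → D n → Set ℓ
    _↝_  : ∀ {k} → D (1+ (1+ k)) → D (1+ k) → Set ℓ

module _ {ℓ : Level} (S : Sig ℓ) where
  open Sig S

  Ext≃ : ∀ {k} → D (1+ k) → D (1+ k) → Set ℓ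
  Ext≃ a b = ∀ x → (app a x ⇔ app b x)

  Down≈ : ∀ {k} → D (1+ k) → D (1+ k) → Set ℓ
  Down≈ {0}    a b = ⊤
  Down≈ {1+ k} a b = ∀ x → (a ↝ x ⇔ b ↝ x)

record DownStructure (ℓ : Level) : Set (suc ℓ) where
  infix 4 _≃_ _≈_
  field
    sig : Sig ℓ
  open Sig sig public

  _≃_ : ∀ {k} → D (1+ k) → D (1+ k) → Set ℓ
  _≃_ = Ext≃ sig

  _≈_ : ∀ {k} → D (1+ k) → D (1+ k) → Set ℓ
  _≈_ = Down≈ sig

  field
    Down-∃   : ∀ {k} (z : D (1+ (1+ k))) → Σ (D (1+ k)) (λ x → z ↝ x)
    Down-Sim : ∀ {k} (z : D (1+ (1+ k))) (x y : D (1+ k)) →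
               z ↝ x → z ↝ y → (x ≃ y) × (y ≈ x)
    Down-Max : ∀ {k} (z : D (1+ (1+ k))) (x y : D (1+ k)) →
               z ↝ x → x ≃ y → y ≈ x → z ↝ y

{-# OPTIONS --safe #-}
-- The Down axioms say that the ↝-image of a type-(n+1) object z is exactly
-- one class of the relation x ∼ y := x ≃ y ∧ y ≈ x.  Hence two chains go down
-- in lockstep: ≈ at level i+1 forces ∼ at level i (the children lie in one
-- class), and ∼ at level i forces ≈ at level i+1 (both parents have the same
-- class as image).  Part (1) is downward induction from the top link
-- a^{n+1} ↝ b^n, part (2) upward induction from b^m ≈ a^m, closed off by
-- Down-Max at the top.
module Submission where

open import Defs
open import Level using (Level)
open import Data.Nat using (ℕ; zero; suc; _≤_; _<_; z≤n; s≤s; s≤s⁻¹)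
open import Data.Nat.Properties using (≤-refl; m≤n⇒m<n∨m≡n; m<n⇒m<1+n; <⇒≤)
open import Data.Product using (_×_; _,_; proj₂)
open import Data.Sum using (inj₁; inj₂)
open import Data.Unit.Polymorphic using (tt)
open import Function.Bundles using (_⇔_; mk⇔; Equivalence)
open import Function.Properties.Equivalence using (⇔-setoid)
open import Function.Construct.Symmetry using (⇔-sym)
open import Function.Construct.Composition using (_⇔-∘_)
open import Relation.Binary.PropositionalEquality using (refl)
import Relation.Binary.Reasoning.Setoid as SetoidReasoning

downward-induction-≤ : ∀ {ℓ} (P : ℕ → Set ℓ) {k : ℕ} → P k →
                       (∀ j → j < k → P (suc j) → P j) →
                       ∀ j → j ≤ k → P j
downward-induction-≤ P {zero}  Pk step zero    z≤n = Pk
downward-induction-≤ P {suc k} Pk step j j≤1+k with m≤n⇒m<n∨m≡n j≤1+k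
... | inj₂ refl   = Pk
... | inj₁ j<1+k  =
  downward-induction-≤ P (step k ≤-refl Pk) (λ i i<k → step i (m<n⇒m<1+n i<k))
                       j (s≤s⁻¹ j<1+k)

upward-induction-≤ : ∀ {ℓ} (P : ℕ → Set ℓ) {p k : ℕ} → P p →
                     (∀ j → p ≤ j → j < k → P j → P (suc j)) →
                     ∀ j → p ≤ j → j ≤ k → P j
upward-induction-≤ P Pp step zero    z≤n   _     = Pp
upward-induction-≤ P Pp step (suc j) p≤1+j 1+j≤k with m≤n⇒m<n∨m≡n p≤1+j
... | inj₂ refl  = Pp
... | inj₁ p<1+j =
  step j (s≤s⁻¹ p<1+j) 1+j≤k
       (upward-induction-≤ P Pp step j (s≤s⁻¹ p<1+j) (<⇒≤ 1+j≤k))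

module DownClasses {ℓ : Level} (M : DownStructure ℓ) where
  open DownStructure M
  open Equivalence using (to)

  ≃-sym : ∀ {k} {x y : D (suc k)} → x ≃ y → y ≃ x
  ≃-sym x≃y z = ⇔-sym (x≃y z)

  ≃-trans : ∀ {k} {x y w : D (suc k)} → x ≃ y → y ≃ w → x ≃ w
  ≃-trans x≃y y≃w z = y≃w z ⇔-∘ x≃y z

  ≈-sym : ∀ {k} {x y : D (suc k)} → x ≈ y → y ≈ x
  ≈-sym {zero}  _   = tt
  ≈-sym {suc k} x≈y z = ⇔-sym (x≈y z)

  ≈-trans : ∀ {k} {x y w : D (suc k)} → x ≈ y → y ≈ w → x ≈ w
  ≈-trans {zero}  _   _   = tt
  ≈-trans {suc k} x≈y y≈w z = y≈w z ⇔-∘ x≈y z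

  infix 4 _∼_
  _∼_ : ∀ {k} → D (suc k) → D (suc k) → Set ℓ
  x ∼ y = x ≃ y × y ≈ x

  ∼-sym : ∀ {k} {x y : D (suc k)} → x ∼ y → y ∼ x
  ∼-sym (x≃y , y≈x) = ≃-sym x≃y , ≈-sym y≈x

  ∼-trans : ∀ {k} {x y w : D (suc k)} → x ∼ y → y ∼ w → x ∼ w
  ∼-trans (x≃y , y≈x) (y≃w , w≈y) = ≃-trans x≃y y≃w , ≈-trans w≈y y≈x

  ↝-image-is-∼-class : ∀ {k} {z : D (suc (suc k))} {x : D (suc k)} →
                       z ↝ x → ∀ y → (z ↝ y ⇔ x ∼ y)
  ↝-image-is-∼-class {x = x} z↝x y =
    mk⇔ (Down-Sim _ x y z↝x) (λ (x≃y , y≈x) → Down-Max _ x y z↝x x≃y y≈x)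

  ≈-parents⇒∼-children : ∀ {k} {A B : D (suc (suc k))} {a b : D (suc k)} →
                         A ↝ a → B ↝ b → B ≈ A → a ∼ b
  ≈-parents⇒∼-children {b = b} A↝a B↝b B≈A =
    to (↝-image-is-∼-class A↝a b) (to (B≈A b) B↝b)

  ∼-children⇒≈-parents : ∀ {k} {A B : D (suc (suc k))} {a b : D (suc k)} →
                         A ↝ a → B ↝ b → a ∼ b → B ≈ A
  ∼-children⇒≈-parents {A = A} {B} {a} {b} A↝a B↝b a∼b x = begin
    B ↝ x  ≈⟨ ↝-image-is-∼-class B↝b x ⟩
    b ∼ x  ≈⟨ mk⇔ (∼-trans a∼b) (∼-trans (∼-sym a∼b)) ⟩
    a ∼ x  ≈⟨ ⇔-sym (↝-image-is-∼-class A↝a x) ⟩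
    A ↝ x  ∎
    where open SetoidReasoning (⇔-setoid ℓ)

lemmaD2 : ∀ {ℓ : Level} (M : DownStructure ℓ) → let open DownStructure M in
    ∀ (k : ℕ) (a b : (i : ℕ) → D i) →
    (∀ j → suc j ≤ suc k → a (suc (suc j)) ↝ a (suc j)) →
    (∀ j → suc (suc j) ≤ suc k → b (suc (suc j)) ↝ b (suc j)) →
    ((a (suc (suc k)) ↝ b (suc k)) →
       ∀ j → suc j ≤ suc k → (a (suc j) ≃ b (suc j)) × (b (suc j) ≈ a (suc j)))
    ×
    (∀ p → suc p ≤ suc k → b (suc p) ≈ a (suc p) →
       (∀ j → p ≤ j → suc j ≤ suc k → a (suc j) ≃ b (suc j)) →
       (∀ j → p ≤ j → suc j ≤ suc k → b (suc j) ≈ a (suc j))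
       × (a (suc (suc k)) ↝ b (suc k)))
lemmaD2 M k a b a↝ b↝ = part1 , part2
  where
  open DownStructure M
  open DownClasses M
  open Equivalence using (to)

  part1 : a (suc (suc k)) ↝ b (suc k) →
          ∀ j → suc j ≤ suc k → a (suc j) ∼ b (suc j)
  part1 top j j<1+k =
    downward-induction-≤ (λ i → a (suc i) ∼ b (suc i))
      (to (↝-image-is-∼-class (a↝ k ≤-refl) (b (suc k))) top)
      (λ i i<k ∼above → ≈-parents⇒∼-children (a↝ i (s≤s (<⇒≤ i<k))) (b↝ i (s≤s i<k))
                                              (proj₂ ∼above))
      j (s≤s⁻¹ j<1+k)

  part2 : ∀ p → suc p ≤ suc k → b (suc p) ≈ a (suc p) →
          (∀ j → p ≤ j → suc j ≤ suc k → a (suc j) ≃ b (suc j)) →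
          (∀ j → p ≤ j → suc j ≤ suc k → b (suc j) ≈ a (suc j))
          × (a (suc (suc k)) ↝ b (suc k))
  part2 p p<1+k bottom a≃b =
    ≈-chain , Down-Max _ _ _ (a↝ k ≤-refl) (a≃b k p≤k ≤-refl) (≈-chain k p≤k ≤-refl)
    where
    p≤k : p ≤ k
    p≤k = s≤s⁻¹ p<1+k

    ≈-chain : ∀ j → p ≤ j → suc j ≤ suc k → b (suc j) ≈ a (suc j)
    ≈-chain j p≤j j<1+k =
      upward-induction-≤ (λ i → b (suc i) ≈ a (suc i)) bottom
        (λ i p≤i i<k b≈a → ∼-children⇒≈-parents (a↝ i (s≤s (<⇒≤ i<k))) (b↝ i (s≤s i<k))
                                                 (a≃b i p≤i (s≤s (<⇒≤ i<k)) , b≈a))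
        j p≤j (s≤s⁻¹ j<1+k)
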